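{- Let $n\ge1$. The image $\mathsf{s}(\mathcal{D}(n))$ is a sublattice of $\mathbb{N}^r$ (componentwise order, with meet and join the componentwise minimum and maximum).
   Context: $\beta(n)=b_1\cdots b_k$ is the binary expansion ($b_1=1$ most significant); its principal prefix is $b_1\cdots b_r$, where $b_{r+1}$ is the rightmost $0$ of $\beta(n)$ ($r=0$ if none). A hyperbinary expansion of $n$ is a word $d_1\cdots d_k$ over $\{0,1,2\}$ with $\sum_i d_i2^{k-i}=n$; $\mathcal{D}(n)$ is the set of these. For a word $c$, $s_j(c)=\sum_{i=1}^jc_i2^{j-i}$ and $\mathsf{s}(c)=(s_1(c),\dots,s_r(c))$. -}

module Defs where

open import Data.Nat using (ℕ; zero; suc; _+_; _*_; _≤_; _%_; _/_; _⊓_; _⊔_)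
open import Data.List using (List; []; _∷_; reverse; foldl; take; length)
open import Data.List.Relation.Unary.All using (All)
open import Data.Vec using (Vec; tabulate; zipWith)
open import Data.Fin using (Fin; toℕ)
open import Data.Bool using (Bool; true; false; if_then_else_)
open import Data.Product using (Σ; _×_)
open import Relation.Binary.PropositionalEquality using (_≡_)

-- Binary digits of m, least significant first; the first argument is fuel
-- (fuel n suffices for m = n).
binRev : ℕ → ℕ → List ℕ
binRev zero    _       = []
binRev (suc f) zero    = []
binRev (suc f) (suc m) = (suc m % 2) ∷ binRev f (suc m / 2)

β : ℕ → List ℕ
β n = reverse (binRev n n)

binLength : ℕ → ℕ
binLength n = length (β n)

val : List ℕ → ℕ
val = foldl (λ a d → a * 2 + d) 0

hasZero : List ℕ → Bool
hasZero []             = false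
hasZero (zero  ∷ _)    = true
hasZero (suc _ ∷ bs)   = hasZero bs

-- r such that b_{r+1} is the rightmost 0 of the word (r = 0 if there is none)
ppLength : List ℕ → ℕ
ppLength []       = 0
ppLength (b ∷ bs) = if hasZero bs then suc (ppLength bs) else 0

r : ℕ → ℕ
r n = ppLength (β n)

HyperBinary : ℕ → List ℕ → Set
HyperBinary n d = (length d ≡ binLength n) × All (_≤ 2) d × (val d ≡ n)

s_ : ℕ → List ℕ → ℕ
s_ j c = val (take j c)

svec : (m : ℕ) → List ℕ → Vec ℕ m
svec m c = tabulate (λ (j : Fin m) → s_ (suc (toℕ j)) c)

InImage : (n : ℕ) → Vec ℕ (r n) → Set
InImage n v = Σ (List ℕ) (λ d → HyperBinary n d × (svec (r n) d ≡ v))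

-- A word d over {0,1,2} is determined by its running values s_j(d), and the
-- sequences that arise are exactly those with s_0 = 0 and
-- 2 s_{j-1} ≤ s_j ≤ 2 s_{j-1} + 2.  Min and max are monotone, idempotent and
-- commute with x ↦ 2x and x ↦ x + 2, so they preserve this condition as well
-- as s_k = n: the componentwise min (max) of the running values of two
-- hyperbinary expansions of n are the running values of a third one.
module Submission where

open import Defs
open import Algebra.Definitions using (Idempotent)
open import Data.Nat using (ℕ; zero; suc; _+_; _*_; _∸_; _≤_; _⊓_; _⊔_)
open import Data.Nat.Properties
open import Data.List using (List; []; _∷_; foldl; take; length)
open import Data.List.Properties using (length-take)
open import Data.List.Relation.Unary.All using (All; []; _∷_)
open import Data.Vec using (Vec; zipWith; tabulate)
open import Data.Vec.Properties using (tabulate-cong)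
open import Data.Fin using (Fin; toℕ)
open import Data.Product using (_×_; _,_)
open import Function using (_∘_)
open import Relation.Binary.Core using (_Preserves₂_⟶_⟶_)
open import Relation.Binary.PropositionalEquality

zipWith-tabulate : ∀ {A B C : Set} {m} (f : A → B → C) (g : Fin m → A) (h : Fin m → B) →
                   zipWith f (tabulate g) (tabulate h) ≡ tabulate (λ i → f (g i) (h i))
zipWith-tabulate {m = zero}  f g h = refl
zipWith-tabulate {m = suc m} f g h =
  cong (f (g Fin.zero) (h Fin.zero) ∷_) (zipWith-tabulate f (g ∘ Fin.suc) (h ∘ Fin.suc))
  where import Data.Fin as Fin
        open Data.Vec using (_∷_)

push : ℕ → ℕ → ℕ
push a d = a * 2 + d

module DigitwiseMerge
  (_∙_ : ℕ → ℕ → ℕ)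
  (∙-mono-≤ : _∙_ Preserves₂ _≤_ ⟶ _≤_ ⟶ _≤_)
  (*-distribʳ-∙ : ∀ a b → (a ∙ b) * 2 ≡ (a * 2) ∙ (b * 2))
  (+-distribʳ-∙ : ∀ a b → (a ∙ b) + 2 ≡ (a + 2) ∙ (b + 2))
  (∙-idem : Idempotent _≡_ _∙_)
  where

  -- a and b are the values of the prefixes read so far; each digit is chosen
  -- so that the running value of the result is a ∙ b.
  mergeFrom : ℕ → ℕ → List ℕ → List ℕ → List ℕ
  mergeFrom a b (x ∷ xs) (y ∷ ys) =
    (push a x ∙ push b y) ∸ (a ∙ b) * 2 ∷ mergeFrom (push a x) (push b y) xs ys
  mergeFrom _ _ _ _ = []

  merge : List ℕ → List ℕ → List ℕ
  merge = mergeFrom 0 0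

  ∙-*2≤∙-push : ∀ a b x y → (a ∙ b) * 2 ≤ push a x ∙ push b y
  ∙-*2≤∙-push a b x y rewrite *-distribʳ-∙ a b = ∙-mono-≤ (m≤m+n (a * 2) x) (m≤m+n (b * 2) y)

  ∙-push≤∙-*2+2 : ∀ a b {x y} → x ≤ 2 → y ≤ 2 → push a x ∙ push b y ≤ (a ∙ b) * 2 + 2
  ∙-push≤∙-*2+2 a b x≤2 y≤2 rewrite *-distribʳ-∙ a b | +-distribʳ-∙ (a * 2) (b * 2) =
    ∙-mono-≤ (+-monoʳ-≤ (a * 2) x≤2) (+-monoʳ-≤ (b * 2) y≤2)

  mergeFrom-digits≤2 : ∀ a b {xs ys} → All (_≤ 2) xs → All (_≤ 2) ys →
                       All (_≤ 2) (mergeFrom a b xs ys)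
  mergeFrom-digits≤2 a b []         _          = []
  mergeFrom-digits≤2 a b (_ ∷ _)    []         = []
  mergeFrom-digits≤2 a b (x≤2 ∷ xs) (y≤2 ∷ ys) =
    m≤n+o⇒m∸n≤o _ ((a ∙ b) * 2) (∙-push≤∙-*2+2 a b x≤2 y≤2) ∷ mergeFrom-digits≤2 _ _ xs ys

  length-mergeFrom : ∀ a b xs ys → length xs ≡ length ys → length (mergeFrom a b xs ys) ≡ length xs
  length-mergeFrom a b []       []       _  = refl
  length-mergeFrom a b (x ∷ xs) (y ∷ ys) eq = cong suc (length-mergeFrom _ _ xs ys (suc-injective eq))

  take-mergeFrom : ∀ j a b xs ys → take j (mergeFrom a b xs ys) ≡ mergeFrom a b (take j xs) (take j ys)
  take-mergeFrom zero    a b xs       ys       = refl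
  take-mergeFrom (suc j) a b []       ys       = refl
  take-mergeFrom (suc j) a b (x ∷ xs) []       = refl
  take-mergeFrom (suc j) a b (x ∷ xs) (y ∷ ys) = cong (_ ∷_) (take-mergeFrom j _ _ xs ys)

  foldl-mergeFrom : ∀ a b xs ys → length xs ≡ length ys →
                    foldl push (a ∙ b) (mergeFrom a b xs ys) ≡ foldl push a xs ∙ foldl push b ys
  foldl-mergeFrom a b []       []       _ = refl
  foldl-mergeFrom a b (x ∷ xs) (y ∷ ys) eq
    rewrite m+[n∸m]≡n (∙-*2≤∙-push a b x y) = foldl-mergeFrom (push a x) (push b y) xs ys (suc-injective eq)

  val-merge : ∀ xs ys → length xs ≡ length ys → val (merge xs ys) ≡ val xs ∙ val ys
  val-merge xs ys eq = subst (λ z → foldl push z (merge xs ys) ≡ val xs ∙ val ys)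
                             (∙-idem 0) (foldl-mergeFrom 0 0 xs ys eq)

  s-merge : ∀ j xs ys → length xs ≡ length ys → s_ j (merge xs ys) ≡ s_ j xs ∙ s_ j ys
  s-merge j xs ys eq = begin
    val (take j (merge xs ys))             ≡⟨ cong val (take-mergeFrom j 0 0 xs ys) ⟩
    val (merge (take j xs) (take j ys))    ≡⟨ val-merge (take j xs) (take j ys) length-take-eq ⟩
    val (take j xs) ∙ val (take j ys)      ∎
    where
    open ≡-Reasoning
    length-take-eq : length (take j xs) ≡ length (take j ys)
    length-take-eq = trans (length-take j xs) (trans (cong (j ⊓_) eq) (sym (length-take j ys)))

  svec-merge : ∀ m xs ys → length xs ≡ length ys →
               svec m (merge xs ys) ≡ zipWith _∙_ (svec m xs) (svec m ys)
  svec-merge m xs ys eq = trans (tabulate-cong (λ j → s-merge (suc (toℕ j)) xs ys eq))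
                                (sym (zipWith-tabulate _∙_ _ _))

  HyperBinary-merge : ∀ {n xs ys} → HyperBinary n xs → HyperBinary n ys → HyperBinary n (merge xs ys)
  HyperBinary-merge {n} {xs} {ys} (len-xs , xs≤2 , val-xs) (len-ys , ys≤2 , val-ys) =
    trans (length-mergeFrom 0 0 xs ys eq) len-xs ,
    mergeFrom-digits≤2 0 0 xs≤2 ys≤2 ,
    (begin
      val (merge xs ys)   ≡⟨ val-merge xs ys eq ⟩
      val xs ∙ val ys     ≡⟨ cong₂ _∙_ val-xs val-ys ⟩
      n ∙ n               ≡⟨ ∙-idem n ⟩
      n                   ∎)
    where
    open ≡-Reasoning
    eq : length xs ≡ length ys
    eq = trans len-xs (sym len-ys)

  InImage-zipWith : ∀ {n u v} → InImage n u → InImage n v → InImage n (zipWith _∙_ u v)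
  InImage-zipWith {n} (xs , hb-xs@(len-xs , _) , refl) (ys , hb-ys@(len-ys , _) , refl) =
    merge xs ys , HyperBinary-merge hb-xs hb-ys , svec-merge (r n) xs ys (trans len-xs (sym len-ys))

module Meet = DigitwiseMerge _⊓_ ⊓-mono-≤ (*-distribʳ-⊓ 2) (+-distribʳ-⊓ 2) ⊓-idem
module Join = DigitwiseMerge _⊔_ ⊔-mono-≤ (*-distribʳ-⊔ 2) (+-distribʳ-⊔ 2) ⊔-idem

proposition3p11 : (n : ℕ) → 1 ≤ n → (u v : Vec ℕ (r n)) → InImage n u → InImage n v →
    InImage n (zipWith _⊓_ u v) × InImage n (zipWith _⊔_ u v)
proposition3p11 n _ u v u∈ v∈ = Meet.InImage-zipWith u∈ v∈ , Join.InImage-zipWith u∈ v∈
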